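{- Let $s,s'\ge1$ and $B:=B(s'\omega_1)\otimes B(s\omega_1)$ of type $A_2$. Let $C:=B\oplus B'$ be a type $A_2$ crystal having $B$ as a direct summand, and let $\mathrm{pr}$ be a promotion operator on $C$. Assume that for every element $u$ of the inversionless component of $B$ and every $k\ge0$, $\mathrm{pr}^k(u)=\mathfrak{pr}^k(u)$. Then $\mathrm{pr}(b)=\mathfrak{pr}(b)$ for all $b\in B$.
   Context: Type $A_2$ over $\{1,2,3\}$: $B(s\omega_1)$ is the set of weakly increasing words of length $s$, weight $=$ content. For $i\in\{1,2\}$, $e_i,f_i$ on $v'\otimes v$ act via the bracketing rule on the concatenated word $v'v$ (letters $i\mapsto$ ")", $i+1\mapsto$ "(", match "()"; $f_i$ changes the $i$ of the rightmost unmatched ")" into $i+1$, $e_i$ the $i+1$ of the leftmost unmatched "(" into $i$, else $\emptyset$). A type $A_2$ crystal $C$ here is a disjoint union of such crystals (tensor products of type $A_2$ highest weight tableau crystals). A promotion operator on $C$ is a map $\mathrm{pr}:C\to C$ with (1) $\mathrm{wt}(b)=(w_1,w_2,w_3)\Rightarrow\mathrm{wt}(\mathrm{pr}(b))=(w_3,w_1,w_2)$; (2) $\mathrm{pr}^3=\mathrm{id}$; (3) $\mathrm{pr}\circ e_1=e_2\circ\mathrm{pr}$, $\mathrm{pr}\circ f_1=f_2\circ\mathrm{pr}$. The canonical promotion on $B$ is $\mathfrak{pr}(v'\otimes v)=\mathfrak{pr}(v')\otimes\mathfrak{pr}(v)$, where on a row $v$, $\mathfrak{pr}(v)$ removes the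 letters $3$, puts that many $0$s at the front and adds $1$ to every letter. The inversionless component of $B$ is the connected component (under $e_1,e_2,f_1,f_2$) of $B$ containing $1^{s'}\otimes1^s$; it is isomorphic to $B((s+s')\omega_1)$. -}

module Defs where

open import Data.Nat using (ℕ; zero; suc; _≤_; _∸_)
open import Data.Fin using (Fin; zero; suc; inject₁) renaming (_≤_ to _≤ᶠ_; _<_ to _<ᶠ_)
import Data.Fin as Fin
open import Data.List using (List; []; _∷_; _++_; length; reverse; concat; concatMap; map; filter; replicate; take)
open import Data.List.Relation.Unary.All using (All)
open import Data.List.Relation.Unary.Linked using (Linked)
open import Data.List.Relation.Binary.Pointwise using (Pointwise)
open import Data.Maybe using (Maybe; just; nothing)
import Data.Maybe as Maybe
open import Data.Product using (Σ; _×_; _,_; proj₁)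
open import Data.Sum using (_⊎_; inj₁; inj₂)
open import Relation.Binary.PropositionalEquality using (_≡_)
open import Relation.Nullary using (yes; no; ¬_)
open import Relation.Nullary.Decidable using (¬?)

-- The alphabet {1,2,3} is represented by Fin 3:
--   zero ↦ 1,  suc zero ↦ 2,  suc (suc zero) ↦ 3.
-- The index i ∈ {1,2} of e_i, f_i is represented by Fin 2:
--   letter "i" is  inject₁ i  and letter "i+1" is  suc i.

Letter : Set
Letter = Fin 3

Word : Set
Word = List Letter

lo hi : Fin 2 → Letter
lo i = inject₁ i
hi i = suc i

-- Letter i is ")", letter i+1 is "(", and "()" pairs are matched.
-- One left-to-right scan returns the positions of the unmatched ")"
-- (in reverse order, i.e. the head is the rightmost one) and the stack
-- of unmatched "(" (head = most recent, last = leftmost one).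

scan : Fin 2 → Word → ℕ → List ℕ → List ℕ → List ℕ × List ℕ
scan i []       pos cl op = cl , op
scan i (x ∷ xs) pos cl op with x Fin.≟ lo i | x Fin.≟ hi i
... | yes _ | _     with op
...   | []     = scan i xs (suc pos) (pos ∷ cl) []
...   | _ ∷ op' = scan i xs (suc pos) cl op'
scan i (x ∷ xs) pos cl op | no _ | yes _ = scan i xs (suc pos) cl (pos ∷ op)
scan i (x ∷ xs) pos cl op | no _ | no _  = scan i xs (suc pos) cl op

head? : List ℕ → Maybe ℕ
head? []      = nothing
head? (p ∷ _) = just p

last? : List ℕ → Maybe ℕ
last? []          = nothing
last? (p ∷ [])    = just p
last? (_ ∷ q ∷ r) = last? (q ∷ r)

fpos : Fin 2 → Word → Maybe ℕ
fpos i w = head? (proj₁ (scan i w 0 [] []))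

epos : Fin 2 → Word → Maybe ℕ
epos i w = last? (Data.Product.proj₂ (scan i w 0 [] []))

setAt : Word → ℕ → Letter → Word
setAt []       _       _ = []
setAt (x ∷ xs) zero    a = a ∷ xs
setAt (x ∷ xs) (suc n) a = x ∷ setAt xs n a

fW : Fin 2 → Word → Maybe Word
fW i w = Maybe.map (λ p → setAt w p (hi i)) (fpos i w)

eW : Fin 2 → Word → Maybe Word
eW i w = Maybe.map (λ p → setAt w p (lo i)) (epos i w)

-- Semistandard tableaux (English notation, rows listed top to bottom)
-- and tensor products of tableau crystals.

Row : Set
Row = Word

Tableau : Set
Tableau = List Row

-- raw element of a tensor product  T₁ ⊗ T₂ ⊗ ⋯ ⊗ Tₙ
TRaw : Set
TRaw = List Tableau

ColStrict : Row → Row → Set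
ColStrict r r' = (length r' ≤ length r) × Pointwise _<ᶠ_ (take (length r') r) r'

SSYT : List ℕ → Tableau → Set
SSYT λ' t = Pointwise (λ r n → length r ≡ n) t λ'
          × All (Linked _≤ᶠ_) t
          × Linked ColStrict t

TElt : List (List ℕ) → Set
TElt shs = Σ TRaw (λ t → Pointwise (λ tab λ' → SSYT λ' tab) t shs)

readT : Tableau → Word
readT t = concat (reverse t)

wordT : TRaw → Word
wordT ts = concatMap readT ts

-- refill a template with letters of a word in reading order
fillRow : Row → Word → Row × Word
fillRow []      w       = [] , w
fillRow (_ ∷ r) []      = [] , []
fillRow (_ ∷ r) (a ∷ w) with fillRow r w
... | r' , w' = a ∷ r' , w'

fillRows : List Row → Word → List Row × Word
fillRows []       w = [] , w
fillRows (r ∷ rs) w with fillRow r w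
... | r' , w' with fillRows rs w'
...   | rs' , w'' = r' ∷ rs' , w''

fillTab : Tableau → Word → Tableau × Word
fillTab t w with fillRows (reverse t) w
... | rs , w' = reverse rs , w'

fillTens : TRaw → Word → TRaw
fillTens []       w = []
fillTens (t ∷ ts) w with fillTab t w
... | t' , w' = t' ∷ fillTens ts w'

fT : Fin 2 → TRaw → Maybe TRaw
fT i t = Maybe.map (fillTens t) (fW i (wordT t))

eT : Fin 2 → TRaw → Maybe TRaw
eT i t = Maybe.map (fillTens t) (eW i (wordT t))

count : Letter → Word → ℕ
count c w = length (filter (λ x → x Fin.≟ c) w)

Weight : Set
Weight = ℕ × ℕ × ℕ

wtT : TRaw → Weight
wtT t = count zero (wordT t) , count (suc zero) (wordT t) , count (suc (suc zero)) (wordT t)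

-- The crystal B = B(s'ω₁) ⊗ B(s ω₁), and C = B ⊕ B' where
-- B' = ⨁_{j ∈ I} (tensor product of tableau crystals with shapes sh j).

Bshapes : ℕ → ℕ → List (List ℕ)
Bshapes s' s = (s' ∷ []) ∷ (s ∷ []) ∷ []

BElt : ℕ → ℕ → Set
BElt s' s = TElt (Bshapes s' s)

CElt : ℕ → ℕ → (I : Set) → (I → List (List ℕ)) → Set
CElt s' s I sh = BElt s' s ⊎ Σ I (λ j → TElt (sh j))

CRaw : Set → Set
CRaw I = TRaw ⊎ (I × TRaw)

rawC : ∀ {s' s I sh} → CElt s' s I sh → CRaw I
rawC (inj₁ (t , _))      = inj₁ t
rawC (inj₂ (j , t , _))  = inj₂ (j , t)

liftOp : ∀ {I : Set} → (TRaw → Maybe TRaw) → CRaw I → Maybe (CRaw I)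
liftOp g (inj₁ t)       = Maybe.map inj₁ (g t)
liftOp g (inj₂ (j , t)) = Maybe.map (λ t' → inj₂ (j , t')) (g t)

eC fC : ∀ {I : Set} → Fin 2 → CRaw I → Maybe (CRaw I)
eC i = liftOp (eT i)
fC i = liftOp (fT i)

wtC : ∀ {I : Set} → CRaw I → Weight
wtC (inj₁ t)       = wtT t
wtC (inj₂ (_ , t)) = wtT t

iter : ∀ {A : Set} → (A → A) → ℕ → A → A
iter g zero    x = x
iter g (suc k) x = g (iter g k x)

-- partial-map equation  pr ∘ op₁ = op₂ ∘ pr  (with pr(∅) = ∅)
Intertwines : ∀ {s' s I sh} → (CElt s' s I sh → CElt s' s I sh)
            → (CRaw I → Maybe (CRaw I)) → (CRaw I → Maybe (CRaw I)) → Set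
Intertwines {s'} {s} {I} {sh} pr op₁ op₂ =
    (∀ (b b' : CElt s' s I sh) → op₁ (rawC b) ≡ just (rawC b') → op₂ (rawC (pr b)) ≡ just (rawC (pr b')))
  × (∀ (b : CElt s' s I sh) → op₁ (rawC b) ≡ nothing → op₂ (rawC (pr b)) ≡ nothing)

IsPromotion : ∀ {s' s I sh} → (CElt s' s I sh → CElt s' s I sh) → Set
IsPromotion {s'} {s} {I} {sh} pr =
    (∀ (b : CElt s' s I sh) → wtC (rawC (pr b)) ≡ (let (w₁ , w₂ , w₃) = wtC (rawC b) in (w₃ , w₁ , w₂)))
  × (∀ (b : CElt s' s I sh) → pr (pr (pr b)) ≡ b)
  × Intertwines pr (eC zero) (eC (suc zero))
  × Intertwines pr (fC zero) (fC (suc zero))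

bump : Letter → Letter
bump zero             = suc zero
bump (suc zero)       = suc (suc zero)
bump (suc (suc zero)) = zero

prRow : Row → Row
prRow r = replicate (count (suc (suc zero)) r) zero
       ++ map bump (filter (λ x → ¬? (x Fin.≟ suc (suc zero))) r)

prT : TRaw → TRaw
prT = map (map prRow)

-- The inversionless component: connected component of 1^{s'} ⊗ 1^s.

data Reach (x : TRaw) : TRaw → Set where
  here  : Reach x x
  stepE : ∀ {y z} (i : Fin 2) → Reach x y → eT i y ≡ just z → Reach x z
  stepF : ∀ {y z} (i : Fin 2) → Reach x y → fT i y ≡ just z → Reach x z

onesB : ℕ → ℕ → TRaw
onesB s' s = (replicate s' zero ∷ []) ∷ (replicate s zero ∷ []) ∷ []

Inversionless : ∀ {s' s} → BElt s' s → Set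
Inversionless {s'} {s} u = Reach (onesB s' s) (proj₁ u)

module Submission where

-- Say pr agrees with 𝔭𝔯 at b when pr b = 𝔭𝔯 b.  Writing b = 1^a₁ 2^a₂ 3^a₃ ⊗ 1^b₁ 2^b₂ 3^b₃, the 1-bracketing
-- of b and the 2-bracketing of 𝔭𝔯 b = 1^a₃ 2^a₁ 3^a₂ ⊗ 1^b₃ 2^b₁ 3^b₂ consist of the same blocks of brackets, so
-- 𝔭𝔯 carries e₁/f₁-moves of B to e₂/f₂-moves; as pr does the same, agreement propagates along 1-strings.  Since
-- pr³ = 𝔭𝔯³ = id, agreement at two points of a 𝔭𝔯-orbit forces it at the third.  The hypothesis gives agreement
-- at 𝔭𝔯 u for u in the inversionless component, e.g. u = 1^p ⊗ v or u = v ⊗ 3^q; along 1-strings these images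
-- reach every element whose first row, or whose second row, has no 3.  Two orbit arguments and a last reduction
-- along 1-strings cover the rest.

open import Data.Fin using (Fin; zero; suc) renaming (_≤_ to _≤ᶠ_)
import Data.Fin as Fin
open import Data.Fin.Properties using () renaming (≤-irrelevant to ≤ᶠ-irrelevant)
open import Data.List using (List; []; _∷_; _++_; replicate; length; map; filter)
open import Data.List.Properties using (++-identityʳ; ++-assoc; length-++; length-replicate)
open import Data.List.Relation.Binary.Pointwise using ([]; _∷_)
open import Data.List.Relation.Unary.All using ([]; _∷_)
open import Data.List.Relation.Unary.Linked as Linked using (Linked; []; [-]; _∷_)
open import Data.Maybe using (Maybe; just)
import Data.Maybe as Maybe
open import Data.Maybe.Properties using (just-injective)
open import Data.Nat using (ℕ; zero; suc; _+_; _≤_; z≤n; s≤s)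
open import Data.Nat.Properties
  using (+-suc; +-assoc; +-identityʳ; +-comm; suc-injective; ≤-refl; ≤-trans; ≤-total; m≤n+m; m≤n⇒m≤1+n;
         ≡-irrelevant; m≤n⇒∃[o]m+o≡n)
open import Data.Nat.Tactic.RingSolver using (solve-∀)
open import Data.Product using (_×_; _,_; proj₁; proj₂; ∃-syntax)
open import Data.Sum using (inj₁; inj₂)
open import Data.Sum.Properties using (inj₁-injective)
open import Function using (_∘_)
open import Relation.Binary.PropositionalEquality
open import Relation.Nullary.Decidable using (¬?)
open ≡-Reasoning

open import Defs

-- Bracketing of block words

one two three : Letter
one   = zero
two   = suc zero
three = suc (suc zero)

neutral : Fin 2 → Letter
neutral zero       = three
neutral (suc zero) = one

pushRun : ℕ → ℕ → List ℕ → List ℕ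
pushRun p zero    l = l
pushRun p (suc n) l = n + p ∷ pushRun p n l

pushRun-suc : ∀ p n l → pushRun (suc p) n (p ∷ l) ≡ pushRun p (suc n) l
pushRun-suc p zero    l = refl
pushRun-suc p (suc n) l = cong₂ _∷_ (+-suc n p) (pushRun-suc p n l)

pushRun-+ : ∀ p t r l → pushRun p (r + t) l ≡ pushRun (t + p) r (pushRun p t l)
pushRun-+ p t zero    l = refl
pushRun-+ p t (suc r) l = cong₂ _∷_ (+-assoc r t p) (pushRun-+ p t r l)

last?-pushRun-∷ : ∀ q n x l → last? (pushRun q n (x ∷ l)) ≡ last? (x ∷ l)
last?-pushRun-∷ q zero          x l = refl
last?-pushRun-∷ q (suc zero)    x l = refl
last?-pushRun-∷ q (suc (suc n)) x l = last?-pushRun-∷ q (suc n) x l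

last?-pushRun : ∀ p n → last? (pushRun p (suc n) []) ≡ just p
last?-pushRun p zero    = refl
last?-pushRun p (suc n) = last?-pushRun p n

scan-lo-unmatched : ∀ i xs pos cl → scan i (lo i ∷ xs) pos cl [] ≡ scan i xs (suc pos) (pos ∷ cl) []
scan-lo-unmatched zero       xs pos cl = refl
scan-lo-unmatched (suc zero) xs pos cl = refl

scan-lo-matched : ∀ i xs pos cl o op → scan i (lo i ∷ xs) pos cl (o ∷ op) ≡ scan i xs (suc pos) cl op
scan-lo-matched zero       xs pos cl o op = refl
scan-lo-matched (suc zero) xs pos cl o op = refl

scan-hi : ∀ i xs pos cl op → scan i (hi i ∷ xs) pos cl op ≡ scan i xs (suc pos) cl (pos ∷ op)
scan-hi zero       xs pos cl op = refl
scan-hi (suc zero) xs pos cl op = refl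

scan-neutral : ∀ i xs pos cl op → scan i (neutral i ∷ xs) pos cl op ≡ scan i xs (suc pos) cl op
scan-neutral zero       xs pos cl op = refl
scan-neutral (suc zero) xs pos cl op = refl

scan-neutrals : ∀ i n xs pos cl op →
  scan i (replicate n (neutral i) ++ xs) pos cl op ≡ scan i xs (n + pos) cl op
scan-neutrals i zero    xs pos cl op = refl
scan-neutrals i (suc n) xs pos cl op = begin
  scan i (neutral i ∷ replicate n (neutral i) ++ xs) pos cl op ≡⟨ scan-neutral i _ pos cl op ⟩
  scan i (replicate n (neutral i) ++ xs) (suc pos) cl op       ≡⟨ scan-neutrals i n xs (suc pos) cl op ⟩
  scan i xs (n + suc pos) cl op                                ≡⟨ cong (λ k → scan i xs k cl op) (+-suc n pos) ⟩
  scan i xs (suc n + pos) cl op                                ∎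

scan-his : ∀ i n xs pos cl op →
  scan i (replicate n (hi i) ++ xs) pos cl op ≡ scan i xs (n + pos) cl (pushRun pos n op)
scan-his i zero    xs pos cl op = refl
scan-his i (suc n) xs pos cl op = begin
  scan i (hi i ∷ replicate n (hi i) ++ xs) pos cl op
    ≡⟨ scan-hi i _ pos cl op ⟩
  scan i (replicate n (hi i) ++ xs) (suc pos) cl (pos ∷ op)
    ≡⟨ scan-his i n xs (suc pos) cl (pos ∷ op) ⟩
  scan i xs (n + suc pos) cl (pushRun (suc pos) n (pos ∷ op))
    ≡⟨ cong₂ (λ k o → scan i xs k cl o) (+-suc n pos) (pushRun-suc pos n op) ⟩
  scan i xs (suc n + pos) cl (pushRun pos (suc n) op) ∎

scan-los-unmatched : ∀ i n xs pos cl →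
  scan i (replicate n (lo i) ++ xs) pos cl [] ≡ scan i xs (n + pos) (pushRun pos n cl) []
scan-los-unmatched i zero    xs pos cl = refl
scan-los-unmatched i (suc n) xs pos cl = begin
  scan i (lo i ∷ replicate n (lo i) ++ xs) pos cl []
    ≡⟨ scan-lo-unmatched i _ pos cl ⟩
  scan i (replicate n (lo i) ++ xs) (suc pos) (pos ∷ cl) []
    ≡⟨ scan-los-unmatched i n xs (suc pos) (pos ∷ cl) ⟩
  scan i xs (n + suc pos) (pushRun (suc pos) n (pos ∷ cl)) []
    ≡⟨ cong₂ (λ k c → scan i xs k c []) (+-suc n pos) (pushRun-suc pos n cl) ⟩
  scan i xs (suc n + pos) (pushRun pos (suc n) cl) [] ∎

scan-los-matched : ∀ i n xs pos cl p op →
  scan i (replicate n (lo i) ++ xs) pos cl (pushRun p n op) ≡ scan i xs (n + pos) cl op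
scan-los-matched i zero    xs pos cl p op = refl
scan-los-matched i (suc n) xs pos cl p op = begin
  scan i (lo i ∷ replicate n (lo i) ++ xs) pos cl (n + p ∷ pushRun p n op)
    ≡⟨ scan-lo-matched i _ pos cl _ _ ⟩
  scan i (replicate n (lo i) ++ xs) (suc pos) cl (pushRun p n op)
    ≡⟨ scan-los-matched i n xs (suc pos) cl p op ⟩
  scan i xs (n + suc pos) cl op
    ≡⟨ cong (λ k → scan i xs k cl op) (+-suc n pos) ⟩
  scan i xs (suc n + pos) cl op ∎

replicate-+ : ∀ {A : Set} m n (x : A) ys → replicate (m + n) x ++ ys ≡ replicate m x ++ replicate n x ++ ys
replicate-+ zero    n x ys = refl
replicate-+ (suc m) n x ys = cong (x ∷_) (replicate-+ m n x ys)

replicate-∷ : ∀ {A : Set} n (x : A) ys → replicate n x ++ x ∷ ys ≡ replicate (suc n) x ++ ys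
replicate-∷ zero    x ys = refl
replicate-∷ (suc n) x ys = cong (x ∷_) (replicate-∷ n x ys)

setAt-replicate-++ : ∀ n x ys m c → setAt (replicate n x ++ ys) (n + m) c ≡ replicate n x ++ setAt ys m c
setAt-replicate-++ zero    x ys m c = refl
setAt-replicate-++ (suc n) x ys m c = cong (x ∷_) (setAt-replicate-++ n x ys m c)

setAt-last-replicate : ∀ n x ys c → setAt (replicate (suc n) x ++ ys) n c ≡ replicate n x ++ c ∷ ys
setAt-last-replicate zero    x ys c = refl
setAt-last-replicate (suc n) x ys c = cong (x ∷_) (setAt-last-replicate n x ys c)

-- Letters lo i, hi i and neutral i play the roles of ")", "(" and an unbracketed letter.
bracketPrefix : Fin 2 → (n₀ p q n₁ : ℕ) → Word → Word
bracketPrefix i n₀ p q n₁ ys =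
  replicate n₀ (neutral i) ++ replicate p (lo i) ++ replicate q (hi i) ++ replicate n₁ (neutral i) ++ ys

bracketWord : Fin 2 → (n₀ p q n₁ r z n₂ : ℕ) → Word
bracketWord i n₀ p q n₁ r z n₂ =
  bracketPrefix i n₀ p q n₁ (replicate r (lo i) ++ replicate z (hi i) ++ replicate n₂ (neutral i))

setAt-bracketPrefix : ∀ i n₀ p q n₁ ys m c →
  setAt (bracketPrefix i n₀ p q n₁ ys) (n₀ + (p + (q + (n₁ + m)))) c ≡ bracketPrefix i n₀ p q n₁ (setAt ys m c)
setAt-bracketPrefix i n₀ p q n₁ ys m c =
  trans (setAt-replicate-++ n₀ _ _ _ c) (cong (replicate n₀ (neutral i) ++_)
  (trans (setAt-replicate-++ p _ _ _ c) (cong (replicate p (lo i) ++_)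
  (trans (setAt-replicate-++ q _ _ _ c) (cong (replicate q (hi i) ++_)
  (setAt-replicate-++ n₁ _ _ _ c))))))

-- If r = q + t, every opening of the q-block is closed and t closings of the r-block stay unmatched; if
-- q = r + t (next lemma), the first t openings of the q-block stay unmatched.
scan-bracketWord-≤ : ∀ i n₀ p q n₁ t z n₂ →
  let b = n₁ + (q + (p + (n₀ + 0))) in
  scan i (bracketWord i n₀ p q n₁ (q + t) z n₂) 0 [] []
  ≡ (pushRun (q + b) t (pushRun (n₀ + 0) p []) , pushRun (t + (q + b)) z [])
scan-bracketWord-≤ i n₀ p q n₁ t z n₂ =
  trans (scan-neutrals i n₀ _ 0 [] [])
  (trans (scan-los-unmatched i p _ _ [])
  (trans (scan-his i q _ _ _ [])
  (trans (scan-neutrals i n₁ _ _ _ _)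
  (trans (cong (λ w → scan i w _ _ _) (replicate-+ q t (lo i) _))
  (trans (scan-los-matched i q _ _ _ _ [])
  (trans (scan-los-unmatched i t _ _ _)
  (trans (scan-his i z _ _ _ [])
  (trans (cong (λ w → scan i w _ _ _) (sym (++-identityʳ (replicate n₂ (neutral i)))))
  (scan-neutrals i n₂ [] _ _ _)))))))))

scan-bracketWord-≥ : ∀ i n₀ p r t n₁ z n₂ →
  let a = p + (n₀ + 0) ; b = n₁ + ((r + t) + a) in
  scan i (bracketWord i n₀ p (r + t) n₁ r z n₂) 0 [] []
  ≡ (pushRun (n₀ + 0) p [] , pushRun (r + b) z (pushRun a t []))
scan-bracketWord-≥ i n₀ p r t n₁ z n₂ =
  trans (scan-neutrals i n₀ _ 0 [] [])
  (trans (scan-los-unmatched i p _ _ [])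
  (trans (scan-his i (r + t) _ _ _ [])
  (trans (scan-neutrals i n₁ _ _ _ _)
  (trans (cong (scan i rest b cl) (pushRun-+ a t r []))
  (trans (scan-los-matched i r _ b cl (t + a) (pushRun a t []))
  (trans (scan-his i z _ _ _ _)
  (trans (cong (λ w → scan i w (z + (r + b)) cl _) (sym (++-identityʳ (replicate n₂ (neutral i)))))
  (scan-neutrals i n₂ [] _ _ _))))))))
  where
  a = p + (n₀ + 0)
  b = n₁ + ((r + t) + a)
  cl = pushRun (n₀ + 0) p []
  rest = replicate r (lo i) ++ replicate z (hi i) ++ replicate n₂ (neutral i)

record BracketMove (opW : Fin 2 → Word → Maybe Word) (p q r z p' q' r' z' : ℕ) : Set where
  field
    on-bracketWord : ∀ i n₀ n₁ n₂ → opW i (bracketWord i n₀ p q n₁ r z n₂) ≡ just (bracketWord i n₀ p' q' n₁ r' z' n₂)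
open BracketMove

fW-at : ∀ i w m → fpos i w ≡ just m → fW i w ≡ just (setAt w m (hi i))
fW-at i w m = cong (Maybe.map (λ k → setAt w k (hi i)))

eW-at : ∀ i w m → epos i w ≡ just m → eW i w ≡ just (setAt w m (lo i))
eW-at i w m = cong (Maybe.map (λ k → setAt w k (lo i)))

fW-bracketWord-right : ∀ {p q r z} → q ≤ r → BracketMove fW p q (suc r) z p q r (suc z)
fW-bracketWord-right {p} {q} {r} {z} q≤r .on-bracketWord i n₀ n₁ n₂ with m≤n⇒∃[o]m+o≡n q≤r
... | t , refl = trans (fW-at i _ _ position) (cong just changed)
  where
  position : fpos i (bracketWord i n₀ p q n₁ (suc (q + t)) z n₂) ≡ just (t + (q + (n₁ + (q + (p + (n₀ + 0))))))
  position = trans (cong (λ k → fpos i (bracketWord i n₀ p q n₁ k z n₂)) (sym (+-suc q t)))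
                   (cong (head? ∘ proj₁) (scan-bracketWord-≤ i n₀ p q n₁ (suc t) z n₂))
  arith : ∀ n₀ p q n₁ t → t + (q + (n₁ + (q + (p + (n₀ + 0))))) ≡ n₀ + (p + (q + (n₁ + (q + t))))
  arith = solve-∀
  changed : setAt (bracketWord i n₀ p q n₁ (suc (q + t)) z n₂) (t + (q + (n₁ + (q + (p + (n₀ + 0)))))) (hi i)
          ≡ bracketWord i n₀ p q n₁ (q + t) (suc z) n₂
  changed = trans (cong (λ k → setAt (bracketWord i n₀ p q n₁ (suc (q + t)) z n₂) k (hi i)) (arith n₀ p q n₁ t))
            (trans (setAt-bracketPrefix i n₀ p q n₁ _ (q + t) (hi i))
                   (cong (bracketPrefix i n₀ p q n₁) (setAt-last-replicate (q + t) (lo i) _ (hi i))))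

fW-bracketWord-left : ∀ {p q r z} → r ≤ q → BracketMove fW (suc p) q r z p (suc q) r z
fW-bracketWord-left {p} {q} {r} {z} r≤q .on-bracketWord i n₀ n₁ n₂ with m≤n⇒∃[o]m+o≡n r≤q
... | t , refl = trans (fW-at i _ _ position) (cong just changed)
  where
  position : fpos i (bracketWord i n₀ (suc p) (r + t) n₁ r z n₂) ≡ just (p + (n₀ + 0))
  position = cong (head? ∘ proj₁) (scan-bracketWord-≥ i n₀ (suc p) r t n₁ z n₂)
  arith : ∀ n₀ p → p + (n₀ + 0) ≡ n₀ + p
  arith = solve-∀
  changed : setAt (bracketWord i n₀ (suc p) (r + t) n₁ r z n₂) (p + (n₀ + 0)) (hi i)
          ≡ bracketWord i n₀ p (suc (r + t)) n₁ r z n₂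
  changed = trans (cong (λ k → setAt (bracketWord i n₀ (suc p) (r + t) n₁ r z n₂) k (hi i)) (arith n₀ p))
            (trans (setAt-replicate-++ n₀ _ _ p (hi i))
                   (cong (replicate n₀ (neutral i) ++_) (setAt-last-replicate p (lo i) _ (hi i))))

eW-bracketWord-left : ∀ {p q r z} → r ≤ q → BracketMove eW p (suc q) r z (suc p) q r z
eW-bracketWord-left {p} {q} {r} {z} r≤q .on-bracketWord i n₀ n₁ n₂ with m≤n⇒∃[o]m+o≡n r≤q
... | t , refl = trans (eW-at i _ _ position) (cong just changed)
  where
  a = p + (n₀ + 0)
  position : epos i (bracketWord i n₀ p (suc (r + t)) n₁ r z n₂) ≡ just a
  position = begin
    epos i (bracketWord i n₀ p (suc (r + t)) n₁ r z n₂)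
      ≡⟨ cong (λ k → epos i (bracketWord i n₀ p k n₁ r z n₂)) (sym (+-suc r t)) ⟩
    epos i (bracketWord i n₀ p (r + suc t) n₁ r z n₂)
      ≡⟨ cong (last? ∘ proj₂) (scan-bracketWord-≥ i n₀ p r (suc t) n₁ z n₂) ⟩
    last? (pushRun _ z (pushRun a (suc t) []))
      ≡⟨ last?-pushRun-∷ _ z (t + a) (pushRun a t []) ⟩
    last? (pushRun a (suc t) [])
      ≡⟨ last?-pushRun a t ⟩
    just a ∎
  arith : ∀ n₀ p → p + (n₀ + 0) ≡ n₀ + (p + 0)
  arith = solve-∀
  changed : setAt (bracketWord i n₀ p (suc (r + t)) n₁ r z n₂) a (lo i)
          ≡ bracketWord i n₀ (suc p) (r + t) n₁ r z n₂
  changed = trans (cong (λ k → setAt (bracketWord i n₀ p (suc (r + t)) n₁ r z n₂) k (lo i)) (arith n₀ p))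
            (trans (setAt-replicate-++ n₀ _ _ (p + 0) (lo i))
                   (cong (replicate n₀ (neutral i) ++_)
                     (trans (setAt-replicate-++ p _ _ 0 (lo i)) (replicate-∷ p (lo i) _))))

eW-bracketWord-right : ∀ {p q r z} → q ≤ r → BracketMove eW p q r (suc z) p q (suc r) z
eW-bracketWord-right {p} {q} {r} {z} q≤r .on-bracketWord i n₀ n₁ n₂ with m≤n⇒∃[o]m+o≡n q≤r
... | t , refl = trans (eW-at i _ _ position) (cong just changed)
  where
  m = t + (q + (n₁ + (q + (p + (n₀ + 0)))))
  position : epos i (bracketWord i n₀ p q n₁ (q + t) (suc z) n₂) ≡ just m
  position = trans (cong (last? ∘ proj₂) (scan-bracketWord-≤ i n₀ p q n₁ t (suc z) n₂)) (last?-pushRun m z)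
  arith : ∀ n₀ p q n₁ t → t + (q + (n₁ + (q + (p + (n₀ + 0))))) ≡ n₀ + (p + (q + (n₁ + ((q + t) + 0))))
  arith = solve-∀
  changed : setAt (bracketWord i n₀ p q n₁ (q + t) (suc z) n₂) m (lo i)
          ≡ bracketWord i n₀ p q n₁ (suc (q + t)) z n₂
  changed = trans (cong (λ k → setAt (bracketWord i n₀ p q n₁ (q + t) (suc z) n₂) k (lo i)) (arith n₀ p q n₁ t))
            (trans (setAt-bracketPrefix i n₀ p q n₁ _ ((q + t) + 0) (lo i))
                   (cong (bracketPrefix i n₀ p q n₁)
                     (trans (setAt-replicate-++ (q + t) _ _ 0 (lo i)) (replicate-∷ (q + t) (lo i) _))))

-- Rows and two-row tensors

row : ℕ → ℕ → ℕ → Row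
row p q u = replicate p one ++ replicate q two ++ replicate u three

_⊗ᵣ_ : Row → Row → TRaw
u ⊗ᵣ v = (u ∷ []) ∷ (v ∷ []) ∷ []

rows : (a₁ a₂ a₃ b₁ b₂ b₃ : ℕ) → TRaw
rows a₁ a₂ a₃ b₁ b₂ b₃ = row a₁ a₂ a₃ ⊗ᵣ row b₁ b₂ b₃

length-replicate-++ : ∀ {A : Set} n (x : A) ys → length (replicate n x ++ ys) ≡ n + length ys
length-replicate-++ n x ys = trans (length-++ (replicate n x)) (cong (_+ length ys) (length-replicate n))

length-row : ∀ p q u → length (row p q u) ≡ p + (q + u)
length-row p q u =
  trans (length-replicate-++ p one _)
        (cong (p +_) (trans (length-replicate-++ q two _) (cong (q +_) (length-replicate u))))

wordT-⊗ᵣ : ∀ u v → wordT (u ⊗ᵣ v) ≡ u ++ v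
wordT-⊗ᵣ u v = cong₂ _++_ (++-identityʳ u) (trans (++-identityʳ (v ++ [])) (++-identityʳ v))

wordT-rows₁ : ∀ a₁ a₂ a₃ b₁ b₂ b₃ → wordT (rows a₁ a₂ a₃ b₁ b₂ b₃) ≡ bracketWord zero 0 a₁ a₂ a₃ b₁ b₂ b₃
wordT-rows₁ a₁ a₂ a₃ b₁ b₂ b₃ =
  trans (wordT-⊗ᵣ (row a₁ a₂ a₃) (row b₁ b₂ b₃))
  (trans (++-assoc (replicate a₁ one) _ _) (cong (replicate a₁ one ++_) (++-assoc (replicate a₂ two) _ _)))

wordT-rows₂ : ∀ a₁ a₂ a₃ b₁ b₂ b₃ → wordT (rows a₁ a₂ a₃ b₁ b₂ b₃) ≡ bracketWord (suc zero) a₁ a₂ a₃ b₁ b₂ b₃ 0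
wordT-rows₂ a₁ a₂ a₃ b₁ b₂ b₃ =
  trans (wordT-rows₁ a₁ a₂ a₃ b₁ b₂ b₃)
  (cong (λ w → bracketPrefix (suc zero) a₁ a₂ a₃ b₁ (replicate b₂ two ++ w)) (sym (++-identityʳ _)))

fillRow-++ : ∀ r u v → length u ≡ length r → fillRow r (u ++ v) ≡ (u , v)
fillRow-++ []      []      v e = refl
fillRow-++ (x ∷ r) (a ∷ u) v e rewrite fillRow-++ r u v (suc-injective e) = refl

fillRow-exact : ∀ r u → length u ≡ length r → fillRow r u ≡ (u , [])
fillRow-exact r u e = trans (cong (fillRow r) (sym (++-identityʳ u))) (fillRow-++ r u [] e)

fillTens-⊗ᵣ : ∀ u v u' v' → length u' ≡ length u → length v' ≡ length v → fillTens (u ⊗ᵣ v) (u' ++ v') ≡ u' ⊗ᵣ v'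
fillTens-⊗ᵣ u v u' v' eu ev rewrite fillRow-++ u u' v' eu | fillRow-exact v v' ev = refl

opT : (Fin 2 → Word → Maybe Word) → Fin 2 → TRaw → Maybe TRaw
opT opW i t = Maybe.map (fillTens t) (opW i (wordT t))

opT-⊗ᵣ : ∀ opW i u v u' v' → length u' ≡ length u → length v' ≡ length v →
  opW i (wordT (u ⊗ᵣ v)) ≡ just (wordT (u' ⊗ᵣ v')) → opT opW i (u ⊗ᵣ v) ≡ just (u' ⊗ᵣ v')
opT-⊗ᵣ opW i u v u' v' eu ev step =
  trans (cong (Maybe.map (fillTens (u ⊗ᵣ v))) step)
        (cong just (trans (cong (fillTens (u ⊗ᵣ v)) (wordT-⊗ᵣ u' v')) (fillTens-⊗ᵣ u v u' v' eu ev)))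

sum₃-≡ : ∀ a b a' b' u → a + b ≡ a' + b' → a + (b + u) ≡ a' + (b' + u)
sum₃-≡ a b a' b' u e = trans (sym (+-assoc a b u)) (trans (cong (_+ u) e) (+-assoc a' b' u))

bracketMove-rows : ∀ {opW p q r z p' q' r' z'} c d → BracketMove opW p q r z p' q' r' z' →
  p + q ≡ p' + q' → r + z ≡ r' + z' →
  opT opW zero (rows p q c r z d) ≡ just (rows p' q' c r' z' d) ×
  opT opW (suc zero) (rows c p q d r z) ≡ just (rows c p' q' d r' z')
bracketMove-rows {opW} {p} {q} {r} {z} {p'} {q'} {r'} {z'} c d move epq erz =
  opT-⊗ᵣ opW zero (row p q c) (row r z d) (row p' q' c) (row r' z' d)
    (length-row-≡ p' q' c p q c (sum₃-≡ p' q' p q c (sym epq)))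
    (length-row-≡ r' z' d r z d (sum₃-≡ r' z' r z d (sym erz)))
    (trans (cong (opW zero) (wordT-rows₁ p q c r z d))
    (trans (on-bracketWord move zero 0 c d) (cong just (sym (wordT-rows₁ p' q' c r' z' d))))) ,
  opT-⊗ᵣ opW (suc zero) (row c p q) (row d r z) (row c p' q') (row d r' z')
    (length-row-≡ c p' q' c p q (cong (c +_) (sym epq)))
    (length-row-≡ d r' z' d r z (cong (d +_) (sym erz)))
    (trans (cong (opW (suc zero)) (wordT-rows₂ c p q d r z))
    (trans (on-bracketWord move (suc zero) c d 0) (cong just (sym (wordT-rows₂ c p' q' d r' z')))))
  where
  length-row-≡ : ∀ a b u a' b' u' → a + (b + u) ≡ a' + (b' + u') → length (row a b u) ≡ length (row a' b' u')
  length-row-≡ a b u a' b' u' e = trans (length-row a b u) (trans e (sym (length-row a' b' u')))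

count-row : ∀ p q u → count three (row p q u) ≡ u
count-row (suc p) q       u       = count-row p q u
count-row zero    (suc q) u       = count-row zero q u
count-row zero    zero    zero    = refl
count-row zero    zero    (suc u) = cong suc (count-row zero zero u)

filter-row : ∀ p q u → filter (λ x → ¬? (x Fin.≟ three)) (row p q u) ≡ replicate p one ++ replicate q two
filter-row (suc p) q       u       = cong (one ∷_) (filter-row p q u)
filter-row zero    (suc q) u       = cong (two ∷_) (filter-row zero q u)
filter-row zero    zero    zero    = refl
filter-row zero    zero    (suc u) = filter-row zero zero u

map-bump : ∀ p q → map bump (replicate p one ++ replicate q two) ≡ replicate p two ++ replicate q three
map-bump (suc p) q       = cong (two ∷_) (map-bump p q)
map-bump zero    (suc q) = cong (three ∷_) (map-bump zero q)
map-bump zero    zero    = refl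

prRow-row : ∀ p q u → prRow (row p q u) ≡ row u p q
prRow-row p q u rewrite count-row p q u | filter-row p q u | map-bump p q = refl

prT-rows : ∀ a₁ a₂ a₃ b₁ b₂ b₃ → prT (rows a₁ a₂ a₃ b₁ b₂ b₃) ≡ rows a₃ a₁ a₂ b₃ b₁ b₂
prT-rows a₁ a₂ a₃ b₁ b₂ b₃ rewrite prRow-row a₁ a₂ a₃ | prRow-row b₁ b₂ b₃ = refl

-- Elements of B

RowShape : Row → Set
RowShape r = ∃[ p ] ∃[ q ] ∃[ u ] r ≡ row p q u

two∷-shape : ∀ {y : Letter} {r} p q u → two ≤ᶠ y → y ∷ r ≡ row p q u → RowShape (two ∷ y ∷ r)
two∷-shape (suc p) q u () refl
two∷-shape zero    q u _  e = 0 , suc q , u , cong (two ∷_) e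

three∷-shape : ∀ {y : Letter} {r} p q u → three ≤ᶠ y → y ∷ r ≡ row p q u → RowShape (three ∷ y ∷ r)
three∷-shape (suc p) q       u ()       refl
three∷-shape zero    (suc q) u (s≤s ()) refl
three∷-shape zero    zero    u _        e = 0 , 0 , suc u , cong (three ∷_) e

sorted-row : ∀ r → Linked _≤ᶠ_ r → RowShape r
sorted-row []                      _ = 0 , 0 , 0 , refl
sorted-row (zero ∷ [])             _ = 1 , 0 , 0 , refl
sorted-row (suc zero ∷ [])         _ = 0 , 1 , 0 , refl
sorted-row (suc (suc zero) ∷ [])   _ = 0 , 0 , 1 , refl
sorted-row (x ∷ y ∷ r) (x≤y ∷ sorted) with sorted-row (y ∷ r) sorted
sorted-row (zero ∷ y ∷ r)          _ | p , q , u , e = suc p , q , u , cong (zero ∷_) e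
sorted-row (suc zero ∷ y ∷ r)      (x≤y ∷ _) | p , q , u , e = two∷-shape p q u x≤y e
sorted-row (suc (suc zero) ∷ y ∷ r) (x≤y ∷ _) | p , q , u , e = three∷-shape p q u x≤y e

linked-row : ∀ p q u → Linked _≤ᶠ_ (row p q u)
linked-row (suc p) q u = one∷ (row p q u) (linked-row p q u)
  where
  one∷ : ∀ w → Linked _≤ᶠ_ w → Linked _≤ᶠ_ (zero ∷ w)
  one∷ []      _ = [-]
  one∷ (_ ∷ _) l = z≤n ∷ l
linked-row zero (suc zero)    zero          = [-]
linked-row zero (suc zero)    (suc u)       = s≤s z≤n ∷ linked-row zero zero (suc u)
linked-row zero (suc (suc q)) u             = s≤s z≤n ∷ linked-row zero (suc q) u
linked-row zero zero          zero          = []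
linked-row zero zero          (suc zero)    = [-]
linked-row zero zero          (suc (suc u)) = s≤s (s≤s z≤n) ∷ linked-row zero zero (suc u)

module _ {s' s : ℕ} where

  rows-elt : ∀ a₁ a₂ a₃ b₁ b₂ b₃ → a₁ + (a₂ + a₃) ≡ s' → b₁ + (b₂ + b₃) ≡ s → BElt s' s
  rows-elt a₁ a₂ a₃ b₁ b₂ b₃ ea eb = rows a₁ a₂ a₃ b₁ b₂ b₃ ,
    ((trans (length-row a₁ a₂ a₃) ea ∷ []) , (linked-row a₁ a₂ a₃ ∷ []) , [-]) ∷
    ((trans (length-row b₁ b₂ b₃) eb ∷ []) , (linked-row b₁ b₂ b₃ ∷ []) , [-]) ∷ []

  BElt-≡ : (b c : BElt s' s) → proj₁ b ≡ proj₁ c → b ≡ c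
  BElt-≡ (t , ((e₁ ∷ []) , (l₁ ∷ []) , [-]) ∷ ((e₂ ∷ []) , (l₂ ∷ []) , [-]) ∷ [])
         (t , ((e₁' ∷ []) , (l₁' ∷ []) , [-]) ∷ ((e₂' ∷ []) , (l₂' ∷ []) , [-]) ∷ []) refl
    rewrite ≡-irrelevant e₁ e₁' | ≡-irrelevant e₂ e₂'
          | Linked.irrelevant ≤ᶠ-irrelevant l₁ l₁' | Linked.irrelevant ≤ᶠ-irrelevant l₂ l₂' = refl

  BElt-rows : (b : BElt s' s) → ∃[ a₁ ] ∃[ a₂ ] ∃[ a₃ ] ∃[ b₁ ] ∃[ b₂ ] ∃[ b₃ ] proj₁ b ≡ rows a₁ a₂ a₃ b₁ b₂ b₃
  BElt-rows (((r₁ ∷ []) ∷ (r₂ ∷ []) ∷ []) , ((_ ∷ []) , (l₁ ∷ []) , [-]) ∷ ((_ ∷ []) , (l₂ ∷ []) , [-]) ∷ [])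
    with sorted-row r₁ l₁ | sorted-row r₂ l₂
  ... | a₁ , a₂ , a₃ , refl | b₁ , b₂ , b₃ , refl = a₁ , a₂ , a₃ , b₁ , b₂ , b₃ , refl

  rows-sizes : ∀ a₁ a₂ a₃ b₁ b₂ b₃ (b : BElt s' s) → proj₁ b ≡ rows a₁ a₂ a₃ b₁ b₂ b₃ →
    a₁ + (a₂ + a₃) ≡ s' × b₁ + (b₂ + b₃) ≡ s
  rows-sizes a₁ a₂ a₃ b₁ b₂ b₃ (_ , ((e₁ ∷ []) , _ , [-]) ∷ ((e₂ ∷ []) , _ , [-]) ∷ []) refl =
    trans (sym (length-row a₁ a₂ a₃)) e₁ , trans (sym (length-row b₁ b₂ b₃)) e₂

-- Reaching the inversionless component

reach-f₁-right : ∀ k {x a₁ a₃ r z d} → Reach x (rows a₁ 0 a₃ (k + r) z d) → Reach x (rows a₁ 0 a₃ r (k + z) d)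
reach-f₁-right zero    reach = reach
reach-f₁-right (suc k) {x} {a₁} {a₃} {r} {z} {d} reach =
  subst (λ n → Reach x (rows a₁ 0 a₃ r n d)) (+-suc k z)
    (reach-f₁-right k {x} {a₁} {a₃} {r} {suc z} {d} (stepF zero reach step))
  where
  step : fT zero (rows a₁ 0 a₃ (suc (k + r)) z d) ≡ just (rows a₁ 0 a₃ (k + r) (suc z) d)
  step = proj₁ (bracketMove-rows a₃ d (fW-bracketWord-right {a₁} {0} {k + r} {z} z≤n) refl (sym (+-suc (k + r) z)))

reach-f₂-right : ∀ k {x a₁ a₂ b₁ z d} → Reach x (rows a₁ a₂ 0 b₁ (k + z) d) → Reach x (rows a₁ a₂ 0 b₁ z (k + d))
reach-f₂-right zero    reach = reach
reach-f₂-right (suc k) {x} {a₁} {a₂} {b₁} {z} {d} reach =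
  subst (λ n → Reach x (rows a₁ a₂ 0 b₁ z n)) (+-suc k d)
    (reach-f₂-right k {x} {a₁} {a₂} {b₁} {z} {suc d} (stepF (suc zero) reach step))
  where
  step : fT (suc zero) (rows a₁ a₂ 0 b₁ (suc (k + z)) d) ≡ just (rows a₁ a₂ 0 b₁ (k + z) (suc d))
  step = proj₂ (bracketMove-rows a₁ b₁ (fW-bracketWord-right {a₂} {0} {k + z} {d} z≤n) refl (sym (+-suc (k + z) d)))

reach-f₁-left : ∀ k {x p q c z d} → Reach x (rows (k + p) q c 0 z d) → Reach x (rows p (k + q) c 0 z d)
reach-f₁-left zero    reach = reach
reach-f₁-left (suc k) {x} {p} {q} {c} {z} {d} reach =
  subst (λ n → Reach x (rows p n c 0 z d)) (+-suc k q)
    (reach-f₁-left k {x} {p} {suc q} {c} {z} {d} (stepF zero reach step))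
  where
  step : fT zero (rows (suc (k + p)) q c 0 z d) ≡ just (rows (k + p) (suc q) c 0 z d)
  step = proj₁ (bracketMove-rows c d (fW-bracketWord-left {k + p} {q} {0} {z} z≤n) (sym (+-suc (k + p) q)) refl)

reach-f₂-left : ∀ k {x a₁ p q b₁ d} → Reach x (rows a₁ (k + p) q b₁ 0 d) → Reach x (rows a₁ p (k + q) b₁ 0 d)
reach-f₂-left zero    reach = reach
reach-f₂-left (suc k) {x} {a₁} {p} {q} {b₁} {d} reach =
  subst (λ n → Reach x (rows a₁ p n b₁ 0 d)) (+-suc k q)
    (reach-f₂-left k {x} {a₁} {p} {suc q} {b₁} {d} (stepF (suc zero) reach step))
  where
  step : fT (suc zero) (rows a₁ (suc (k + p)) q b₁ 0 d) ≡ just (rows a₁ (k + p) (suc q) b₁ 0 d)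
  step = proj₂ (bracketMove-rows a₁ b₁ (fW-bracketWord-left {k + p} {q} {0} {d} z≤n) (sym (+-suc (k + p) q)) refl)

onesB≡rows : ∀ s' s → onesB s' s ≡ rows s' 0 0 s 0 0
onesB≡rows s' s = cong₂ _⊗ᵣ_ (sym (++-identityʳ (replicate s' one))) (sym (++-identityʳ (replicate s one)))

reach-ones⊗row : ∀ {s' s} p r z d → p + (0 + 0) ≡ s' → r + (z + d) ≡ s → Reach (onesB s' s) (rows p 0 0 r z d)
reach-ones⊗row {s'} {s} p r z d refl refl =
  subst₂ (λ m n → Reach X (rows p 0 0 r m n)) (+-identityʳ z) (+-identityʳ d)
    (reach-f₂-right d {X} {p} {0} {r} {z + 0} {0} (subst (λ n → Reach X (rows p 0 0 r n 0)) (arith₂ z d)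
    (reach-f₁-right (z + d) {X} {p} {0} {r} {0} {0} (subst (Reach X) start here))))
  where
  X = onesB (p + 0) (r + (z + d))
  arith₂ : ∀ z d → (z + d) + 0 ≡ d + (z + 0)
  arith₂ = solve-∀
  arith₁ : ∀ r z d → r + (z + d) ≡ (z + d) + r
  arith₁ = solve-∀
  start : X ≡ rows p 0 0 ((z + d) + r) 0 0
  start = trans (onesB≡rows (p + 0) (r + (z + d))) (cong₂ (λ m n → rows m 0 0 n 0 0) (+-identityʳ p) (arith₁ r z d))

reach-row⊗threes : ∀ {s' s} p q c d → p + (q + c) ≡ s' → 0 + (0 + d) ≡ s → Reach (onesB s' s) (rows p q c 0 0 d)
reach-row⊗threes p q c d refl refl =
  subst₂ (λ m n → Reach X (rows p q m 0 0 n)) (+-identityʳ c) (+-identityʳ d)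
    (reach-f₂-left c {X} {p} {q} {0} {0} {d + 0} (subst (λ n → Reach X (rows p n 0 0 0 (d + 0))) (arith₂ q c)
    (reach-f₁-left (q + c) {X} {p} {0} {0} {0} {d + 0}
    (reach-f₂-right d {X} {(q + c) + p} {0} {0} {0} {0}
    (reach-f₁-right d {X} {(q + c) + p} {0} {0} {0} {0} (subst (Reach X) start here))))))
  where
  X = onesB (p + (q + c)) d
  arith₁ : ∀ p q c → p + (q + c) ≡ (q + c) + p
  arith₁ = solve-∀
  arith₂ : ∀ q c → (q + c) + 0 ≡ c + q
  arith₂ = solve-∀
  start : X ≡ rows ((q + c) + p) 0 0 (d + 0) 0 0
  start = trans (onesB≡rows (p + (q + c)) d) (cong₂ (λ m n → rows m 0 0 n 0 0) (arith₁ p q c) (sym (+-identityʳ d)))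

-- Agreement of pr with 𝔭𝔯

sum₃-rotate : ∀ a b c → c + (a + b) ≡ a + (b + c)
sum₃-rotate = solve-∀

module _ {s' s : ℕ} {I : Set} {sh : I → List (List ℕ)}
         (pr : CElt s' s I sh → CElt s' s I sh) (isP : IsPromotion pr) where

  AgreesAt : BElt s' s → Set
  AgreesAt b = rawC (pr (inj₁ b)) ≡ inj₁ (prT (proj₁ b))

  -- Vacuous unless the rows have lengths s' and s.  In lemma names row₁₂ is a row with letters 1 and 2 only, etc.
  Agrees : (a₁ a₂ a₃ b₁ b₂ b₃ : ℕ) → Set
  Agrees a₁ a₂ a₃ b₁ b₂ b₃ = ∀ (b : BElt s' s) → proj₁ b ≡ rows a₁ a₂ a₃ b₁ b₂ b₃ → AgreesAt b

  rawC≡inj₁ : (x : CElt s' s I sh) (c : BElt s' s) → rawC x ≡ inj₁ (proj₁ c) → x ≡ inj₁ c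
  rawC≡inj₁ (inj₁ b)           c e  = cong inj₁ (BElt-≡ b c (inj₁-injective e))
  rawC≡inj₁ (inj₂ (_ , _ , _)) c ()

  agreesAt-pr : ∀ {b c} → AgreesAt b → prT (proj₁ b) ≡ proj₁ c → pr (inj₁ b) ≡ inj₁ c
  agreesAt-pr {b} {c} agrees e = rawC≡inj₁ (pr (inj₁ b)) c (trans agrees (cong inj₁ e))

  -- pr e₁ = e₂ pr and 𝔭𝔯 e₁ = e₂ 𝔭𝔯 on the move, so agreement propagates along it (likewise for f).
  agrees-along : ∀ {opW p q r z p' q' r' z'} c d →
    Intertwines pr (liftOp (opT opW zero)) (liftOp (opT opW (suc zero))) →
    BracketMove opW p q r z p' q' r' z' → p + q ≡ p' + q' → r + z ≡ r' + z' →
    Agrees p q c r z d → Agrees p' q' c r' z' d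
  agrees-along {opW} {p} {q} {r} {z} {p'} {q'} {r'} {z'} c d (commutes , _) move epq erz agrees b' eb' =
    just-injective (begin
      just (rawC (pr (inj₁ b')))                            ≡⟨ lifted ⟨
      liftOp (opT opW (suc zero)) (rawC (pr (inj₁ b)))      ≡⟨ cong (liftOp (opT opW (suc zero))) agrees-b ⟩
      liftOp (opT opW (suc zero)) (inj₁ (rows c p q d r z)) ≡⟨ cong (Maybe.map inj₁) (proj₂ steps) ⟩
      just (inj₁ (rows c p' q' d r' z'))
        ≡⟨ cong (just ∘ inj₁) (trans (cong prT eb') (prT-rows p' q' c r' z' d)) ⟨
      just (inj₁ (prT (proj₁ b')))                          ∎)
    where
    sizes = rows-sizes p' q' c r' z' d b' eb'
    b : BElt s' s
    b = rows-elt p q c r z d (trans (sum₃-≡ p q p' q' c epq) (proj₁ sizes))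
                             (trans (sum₃-≡ r z r' z' d erz) (proj₂ sizes))
    steps = bracketMove-rows c d move epq erz
    agrees-b : rawC (pr (inj₁ b)) ≡ inj₁ (rows c p q d r z)
    agrees-b = trans (agrees b refl) (cong inj₁ (prT-rows p q c r z d))
    lifted : liftOp (opT opW (suc zero)) (rawC (pr (inj₁ b))) ≡ just (rawC (pr (inj₁ b')))
    lifted = commutes (inj₁ b) (inj₁ b') (cong (Maybe.map inj₁) (trans (proj₁ steps) (cong just (sym eb'))))

  e-commutes : Intertwines pr (eC zero) (eC (suc zero))
  e-commutes = proj₁ (proj₂ (proj₂ isP))

  f-commutes : Intertwines pr (fC zero) (fC (suc zero))
  f-commutes = proj₂ (proj₂ (proj₂ isP))

  agrees-e-left : ∀ k {p q c r z d} → r ≤ q → Agrees p (k + q) c r z d → Agrees (k + p) q c r z d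
  agrees-e-left zero    r≤q agrees = agrees
  agrees-e-left (suc k) {p} {q} {c} {r} {z} {d} r≤q agrees =
    subst (λ n → Agrees n q c r z d) (+-suc k p)
      (agrees-e-left k {suc p} {q} {c} {r} {z} {d} r≤q
        (agrees-along c d e-commutes (eW-bracketWord-left (≤-trans r≤q (m≤n+m q k))) (+-suc p (k + q)) refl agrees))

  agrees-e-right : ∀ k {p q c r z d} → q ≤ r → Agrees p q c r (k + z) d → Agrees p q c (k + r) z d
  agrees-e-right zero    q≤r agrees = agrees
  agrees-e-right (suc k) {p} {q} {c} {r} {z} {d} q≤r agrees =
    subst (λ n → Agrees p q c n z d) (+-suc k r)
      (agrees-e-right k {p} {q} {c} {suc r} {z} {d} (m≤n⇒m≤1+n q≤r)
        (agrees-along c d e-commutes (eW-bracketWord-right {p} q≤r) refl (+-suc r (k + z)) agrees))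

  agrees-f-left : ∀ k {p q c r z d} → r ≤ q → Agrees (k + p) q c r z d → Agrees p (k + q) c r z d
  agrees-f-left zero    r≤q agrees = agrees
  agrees-f-left (suc k) {p} {q} {c} {r} {z} {d} r≤q agrees =
    subst (λ n → Agrees p n c r z d) (+-suc k q)
      (agrees-f-left k {p} {suc q} {c} {r} {z} {d} (m≤n⇒m≤1+n r≤q)
        (agrees-along c d f-commutes (fW-bracketWord-left r≤q) (sym (+-suc (k + p) q)) refl agrees))

  agrees-f-right : ∀ k {p q c r z d} → q ≤ r → Agrees p q c (k + r) z d → Agrees p q c r (k + z) d
  agrees-f-right zero    q≤r agrees = agrees
  agrees-f-right (suc k) {p} {q} {c} {r} {z} {d} q≤r agrees =
    subst (λ n → Agrees p q c r n d) (+-suc k z)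
      (agrees-f-right k {p} {q} {c} {r} {suc z} {d} q≤r
        (agrees-along c d f-commutes (fW-bracketWord-right {p} (≤-trans q≤r (m≤n+m r k)))
          refl (sym (+-suc (k + r) z)) agrees))

  agrees-rotate : ∀ a₁ a₂ a₃ b₁ b₂ b₃ →
    Agrees a₁ a₂ a₃ b₁ b₂ b₃ → Agrees a₃ a₁ a₂ b₃ b₁ b₂ → Agrees a₂ a₃ a₁ b₂ b₃ b₁
  agrees-rotate a₁ a₂ a₃ b₁ b₂ b₃ agrees agrees' b eb = begin
    rawC (pr (inj₁ b))                    ≡⟨ cong (rawC ∘ pr) (sym pr-x₁) ⟩
    rawC (pr (pr (inj₁ x₁)))              ≡⟨ cong (rawC ∘ pr ∘ pr) (sym pr-x) ⟩
    rawC (pr (pr (pr (inj₁ x))))          ≡⟨ cong rawC (proj₁ (proj₂ isP) (inj₁ x)) ⟩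
    inj₁ (rows a₁ a₂ a₃ b₁ b₂ b₃)         ≡⟨ cong inj₁ (trans (cong prT eb) (prT-rows a₂ a₃ a₁ b₂ b₃ b₁)) ⟨
    inj₁ (prT (proj₁ b))                  ∎
    where
    sizes = rows-sizes a₂ a₃ a₁ b₂ b₃ b₁ b eb
    x x₁ : BElt s' s
    x  = rows-elt a₁ a₂ a₃ b₁ b₂ b₃
           (trans (sum₃-rotate a₂ a₃ a₁) (proj₁ sizes))
           (trans (sum₃-rotate b₂ b₃ b₁) (proj₂ sizes))
    x₁ = rows-elt a₃ a₁ a₂ b₃ b₁ b₂
           (trans (sum₃-rotate a₁ a₂ a₃) (trans (sum₃-rotate a₂ a₃ a₁) (proj₁ sizes)))
           (trans (sum₃-rotate b₁ b₂ b₃) (trans (sum₃-rotate b₂ b₃ b₁) (proj₂ sizes)))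
    pr-x : pr (inj₁ x) ≡ inj₁ x₁
    pr-x = agreesAt-pr (agrees x refl) (prT-rows a₁ a₂ a₃ b₁ b₂ b₃)
    pr-x₁ : pr (inj₁ x₁) ≡ inj₁ b
    pr-x₁ = agreesAt-pr (agrees' x₁ refl) (trans (prT-rows a₃ a₁ a₂ b₃ b₁ b₂) (sym eb))

  module _ (hyp : ∀ (u : BElt s' s) → Inversionless u → ∀ (k : ℕ) →
                    rawC (iter pr k (inj₁ u)) ≡ inj₁ (iter prT k (proj₁ u))) where

    agrees-pr-inversionless : ∀ a₁ a₂ a₃ b₁ b₂ b₃ →
      (a₁ + (a₂ + a₃) ≡ s' → b₁ + (b₂ + b₃) ≡ s → Reach (onesB s' s) (rows a₁ a₂ a₃ b₁ b₂ b₃)) →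
      Agrees a₃ a₁ a₂ b₃ b₁ b₂
    agrees-pr-inversionless a₁ a₂ a₃ b₁ b₂ b₃ reach b eb = begin
      rawC (pr (inj₁ b))          ≡⟨ cong (rawC ∘ pr) (sym pr-u) ⟩
      rawC (pr (pr (inj₁ u)))     ≡⟨ hyp u inversionless 2 ⟩
      inj₁ (prT (prT (proj₁ u)))  ≡⟨ cong (inj₁ ∘ prT) image ⟩
      inj₁ (prT (proj₁ b))        ∎
      where
      sizes = rows-sizes a₃ a₁ a₂ b₃ b₁ b₂ b eb
      ea = trans (sym (sum₃-rotate a₁ a₂ a₃)) (proj₁ sizes)
      eb' = trans (sym (sum₃-rotate b₁ b₂ b₃)) (proj₂ sizes)
      u = rows-elt a₁ a₂ a₃ b₁ b₂ b₃ ea eb'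
      inversionless : Inversionless u
      inversionless = reach ea eb'
      image : prT (proj₁ u) ≡ proj₁ b
      image = trans (prT-rows a₁ a₂ a₃ b₁ b₂ b₃) (sym eb)
      pr-u : pr (inj₁ u) ≡ inj₁ b
      pr-u = rawC≡inj₁ (pr (inj₁ u)) b (trans (hyp u inversionless 1) (cong inj₁ image))

    agrees-twos⊗row : ∀ q r z d → Agrees 0 q 0 r z d
    agrees-twos⊗row q r z d = agrees-pr-inversionless q 0 0 z d r (reach-ones⊗row q z d r)

    agrees-row⊗ones : ∀ p q c r → Agrees p q c r 0 0
    agrees-row⊗ones p q c r = agrees-pr-inversionless q c p 0 0 r (reach-row⊗threes q c p r)

    agrees-from-row₂₃⊗ : ∀ {c d} → (∀ n r z → Agrees 0 n c r z d) → ∀ p q r z → Agrees p q c r z d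
    agrees-from-row₂₃⊗ {c} {d} agrees p q r z with ≤-total r q
    ... | inj₁ r≤q = subst (λ n → Agrees n q c r z d) (+-identityʳ p)
                       (agrees-e-left p {0} {q} {c} {r} {z} {d} r≤q (agrees (p + q) r z))
    ... | inj₂ q≤r with m≤n⇒∃[o]m+o≡n q≤r
    ...   | t , refl =
      subst (λ n → Agrees p q c n z d) (+-comm t q)
        (agrees-e-right t {p} {q} {c} {q} {z} {d} ≤-refl
          (subst (λ n → Agrees n q c q (t + z) d) (+-identityʳ p)
            (agrees-e-left p {0} {q} {c} {q} {t + z} {d} ≤-refl (agrees (p + q) q (t + z)))))

    agrees-from-⊗row₁₃ : ∀ {c d} → (∀ p q r → Agrees p q c r 0 d) → ∀ p q r z → Agrees p q c r z d
    agrees-from-⊗row₁₃ {c} {d} agrees p q r z with ≤-total q r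
    ... | inj₁ q≤r = subst (λ n → Agrees p q c r n d) (+-identityʳ z)
                       (agrees-f-right z {p} {q} {c} {r} {0} {d} q≤r (agrees p q (z + r)))
    ... | inj₂ r≤q with m≤n⇒∃[o]m+o≡n r≤q
    ...   | t , refl =
      subst (λ n → Agrees p n c r z d) (+-comm t r)
        (agrees-f-left t {p} {r} {c} {r} {z} {d} ≤-refl
          (subst (λ n → Agrees (t + p) r c r n d) (+-identityʳ z)
            (agrees-f-right z {t + p} {r} {c} {r} {0} {d} ≤-refl (agrees (t + p) r (z + r)))))

    agrees-row₁₂⊗row : ∀ p q r z d → Agrees p q 0 r z d
    agrees-row₁₂⊗row p q r z d = agrees-from-row₂₃⊗ (λ n r z → agrees-twos⊗row n r z d) p q r z

    agrees-row⊗row₁₂ : ∀ p q c r z → Agrees p q c r z 0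
    agrees-row⊗row₁₂ p q c r z = agrees-from-⊗row₁₃ (λ p q r → agrees-row⊗ones p q c r) p q r z

    agrees-row₁₃⊗row₂₃ : ∀ c n m z → Agrees c 0 n 0 m z
    agrees-row₁₃⊗row₂₃ c n m z =
      agrees-rotate n c 0 z 0 m (agrees-row₁₂⊗row n c z 0 m) (agrees-row⊗row₁₂ 0 n c m z)

    agrees-row₂₃⊗row : ∀ n c r z d → Agrees 0 n c r z d
    agrees-row₂₃⊗row n c r z d = agrees-rotate c 0 n d r z row₁₃⊗row (agrees-row₁₂⊗row n c z d r)
      where
      row₁₃⊗row : Agrees c 0 n d r z
      row₁₃⊗row = subst (λ k → Agrees c 0 n k r z) (+-identityʳ d)
                    (agrees-e-right d {c} {0} {n} {0} {r} {z} z≤n (agrees-row₁₃⊗row₂₃ c n (d + r) z))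

    agrees-everywhere : ∀ p q c r z d → Agrees p q c r z d
    agrees-everywhere p q c r z d = agrees-from-row₂₃⊗ (λ n r z → agrees-row₂₃⊗row n c r z d) p q r z

proposition4p3 : (s' s : ℕ) → 1 ≤ s' → 1 ≤ s →
    (I : Set) (sh : I → List (List ℕ)) →
    (pr : CElt s' s I sh → CElt s' s I sh) → IsPromotion pr →
    (∀ (u : BElt s' s) → Inversionless u → ∀ (k : ℕ) →
        rawC (iter pr k (inj₁ u)) ≡ inj₁ (iter prT k (proj₁ u))) →
    ∀ (b : BElt s' s) → rawC (pr (inj₁ b)) ≡ inj₁ (prT (proj₁ b))
proposition4p3 s' s _ _ I sh pr isP hyp b with BElt-rows b
... | a₁ , a₂ , a₃ , b₁ , b₂ , b₃ , eb = agrees-everywhere pr isP hyp a₁ a₂ a₃ b₁ b₂ b₃ b eb
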